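{- Let $G_m$ be acyclic, let $\hat{\eta}\ge 1$, and for integers $j,k$ let $H_{j,k}$ be the set of vertices $v$ for which $(j,k)$ is a possible level of $v$ with respect to $\hat{\eta}$, together with (at any time $t$) the edges of $G_t$ having both endpoints in $H_{j,k}$. Then for any subproblem $H_{j,k}$ and any vertex $v\in H_{j,k}$, $v$ has at most $2(\hat{\eta}+\eta)$ ancestor edges and at most $2(\hat{\eta}+\eta)$ descendant edges in $H_{j,k}$.
   Context: Incremental setting: vertex set $V$, directed edges arrive one at a time, $G_t$ is the graph after $t$ insertions, $G_m$ the final graph. In a directed graph, $x$ is an ancestor of $y$ ($y$ a descendant of $x$) if there is a directed path from $x$ to $y$; every vertex is its own ancestor and descendant. An edge $(x,y)$ is an ancestor edge of $w$ if $y$ is an ancestor of $w$, and a descendant edge of $w$ if $x$ is a descendant of $w$; "ancestor/descendant edges in $H_{j,k}$" are taken within the subgraph $H_{j,k}$. Let $\alpha(v)$ and $\delta(v)$ be the numbers of ancestor and descendant edges of $v$ in $G_m$. Predictions $\tilde{\alpha}(v),\tilde{\delta}(v)$ are given for each $v$, with error $\eta=\max_v\big(|\tilde{\alpha}(v)-\alpha(v)|+|\tilde{\delta}(v)-\delta(v)|\big)$. For a parameter $\hat{\eta}$, the possible levels of $v$ are the pairs $(j,k)$ with $j\in\{\lceil\tilde{\alpha}(v)/\hat{\eta}\rceil,\lceil\tilde{\alpha}(v)/\hat{\eta}\rceil+1\}$ and $k\in\{\lfloor\tilde{\delta}(v)/\hat{\eta}\rfloor,\lfloor\tilde{\delta}(v)/\hat{\eta}\rfloor-1\}$.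 -}

module Defs where

open import Data.Nat using (ℕ; zero; suc; _+_; _∸_; _⊔_; ∣_-_∣; NonZero)
open import Data.Nat.DivMod using (_/_)
open import Data.Integer using (ℤ; +_; _-_)
open import Data.Fin using (Fin)
open import Data.List using (List; []; _∷_; take; map; foldr; length)
open import Data.List.Membership.Propositional using (_∈_)
open import Data.Product using (_×_; _,_)
open import Data.Sum using (_⊎_)
open import Relation.Nullary using (¬_)
open import Relation.Binary.PropositionalEquality using (_≡_)
open import Relation.Binary.Construct.Closure.ReflexiveTransitive using (Star)
open import Relation.Binary.Construct.Closure.Transitive using (TransClosure)
open import Data.List using (allFin)

Edge : ℕ → Set
Edge n = Fin n × Fin n

EdgeOf : ∀ {n} → List (Edge n) → Fin n → Fin n → Set
EdgeOf E x y = (x , y) ∈ E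

Acyclic : ∀ {n} → List (Edge n) → Set
Acyclic {n} E = (x : Fin n) → ¬ TransClosure (EdgeOf E) x x

data Count {A : Set} (P : A → Set) : List A → ℕ → Set where
  nil  : Count P [] 0
  hit  : ∀ {x xs c} → P x → Count P xs c → Count P (x ∷ xs) (suc c)
  miss : ∀ {x xs c} → ¬ P x → Count P xs c → Count P (x ∷ xs) c

Ancestor : ∀ {n} → (Fin n → Fin n → Set) → Fin n → Fin n → Set
Ancestor R x y = Star R x y

AncEdge : ∀ {n} → (Fin n → Fin n → Set) → Fin n → Edge n → Set
AncEdge R w (x , y) = Ancestor R y w

DescEdge : ∀ {n} → (Fin n → Fin n → Set) → Fin n → Edge n → Set
DescEdge R w (x , y) = Ancestor R w x

⌈_/_⌉ : ℕ → (b : ℕ) → .{{NonZero b}} → ℕ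
⌈ a / b ⌉ = (a + (b ∸ 1)) / b

⌊_/_⌋ : ℕ → (b : ℕ) → .{{NonZero b}} → ℕ
⌊ a / b ⌋ = a / b

PossibleLevel : (η̂ : ℕ) → .{{NonZero η̂}} → (α̃ δ̃ : ℕ) → ℤ → ℤ → Set
PossibleLevel η̂ α̃ δ̃ j k =
  (j ≡ + ⌈ α̃ / η̂ ⌉ ⊎ j ≡ + ⌈ α̃ / η̂ ⌉ Data.Integer.+ + 1) ×
  (k ≡ + ⌊ δ̃ / η̂ ⌋ ⊎ k ≡ + ⌊ δ̃ / η̂ ⌋ - + 1)

predError : ∀ {n} → (α̃ δ̃ α δ : Fin n → ℕ) → ℕ
predError {n} α̃ δ̃ α δ =
  foldr _⊔_ 0 (map (λ v → ∣ α̃ v - α v ∣ + ∣ δ̃ v - δ v ∣) (allFin n))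

-- Edge relation of the subgraph H_{j,k} at time t: edges of G_t = take t E
-- with both endpoints in H (H given as a predicate on vertices).
SubEdge : ∀ {n} → (Fin n → Set) → List (Edge n) → Fin n → Fin n → Set
SubEdge H Et x y = (x , y) ∈ Et × H x × H y

module Submission where

-- Descending from v along counted ancestor edges, each step
-- strictly lowering α because G is acyclic, reaches a vertex x₀ ∈ H which is an ancestor
-- of v but which no counted edge enters.  The counted edges and the ancestor edges of x₀
-- are then disjoint sets of ancestor edges of v, so c + α x₀ ≤ α v.  As v and x₀ share the
-- level j, their predictions differ by at most 2η̂, and each prediction is within η of α,
-- whence c ≤ 2η̂ + 2η.  Descendant edges are the same argument for reversed reachability.

open import Defs
open import Data.Nat using (ℕ; zero; suc; z≤n; s≤s; _+_; _*_; _≤_; _<_; _≤?_; _⊔_; ∣_-_∣; NonZero)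
open import Data.Nat.Properties
open import Data.Nat.DivMod using (_/_; _%_; m≡m%n+[m/n]*n; m%n<n; m/n*n≤m)
open import Data.Nat.Induction using (<-wellFounded)
open import Data.Nat.Tactic.RingSolver using (solve)
open import Data.Integer using (ℤ; +_) renaming (_+_ to _+ℤ_; _-_ to _-ℤ_)
open import Data.Integer.Properties using (+-injective)
open import Data.Fin using (Fin)
open import Data.List using (List; []; _∷_; take; length; map; foldr)
open import Data.List.Membership.Propositional using (_∈_)
open import Data.List.Membership.Propositional.Properties using (∈-allFin)
open import Data.List.Relation.Unary.Any using (here; there)
open import Data.List.Relation.Binary.Sublist.Propositional using (lookup)
open import Data.List.Relation.Binary.Sublist.Propositional.Properties using (take-⊆)
open import Data.Product using (∃; _×_; _,_; proj₁; proj₂)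
open import Data.Sum using (_⊎_; inj₁; inj₂)
open import Data.Empty using (⊥-elim)
open import Function using (flip; _∘_)
open import Induction.WellFounded using (Acc; acc)
open import Relation.Nullary using (¬_)
open import Relation.Nullary.Decidable using (decidable-stable)
open import Relation.Nullary.Negation using (¬¬-map)
open import Relation.Unary using (_⊆_)
open import Relation.Binary.PropositionalEquality using (_≡_; refl; sym; trans; subst)
open import Relation.Binary.Construct.Closure.ReflexiveTransitive as Star
  using (Star; ε; _◅_; _◅◅_)
open import Relation.Binary.Construct.Closure.Transitive
  using (TransClosure; [_]) renaming (_∷_ to _∷⁺_)

private
  variable
    A : Set
    P Q R : A → Set

count-mono : ∀ {xs m n} → Count P xs m → Count Q xs n → P ⊆ Q → m ≤ n
count-mono nil          nil          P⊆Q = z≤n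
count-mono (hit p cp)   (hit q cq)   P⊆Q = s≤s (count-mono cp cq P⊆Q)
count-mono (hit p cp)   (miss ¬q cq) P⊆Q = ⊥-elim (¬q (P⊆Q p))
count-mono (miss ¬p cp) (hit q cq)   P⊆Q = m≤n⇒m≤1+n (count-mono cp cq P⊆Q)
count-mono (miss ¬p cp) (miss ¬q cq) P⊆Q = count-mono cp cq P⊆Q

count-strict : ∀ {xs m n x} → Count P xs m → Count Q xs n → P ⊆ Q →
               x ∈ xs → Q x → ¬ P x → m < n
count-strict (hit p cp)   cq           P⊆Q (here refl) qx ¬px = ⊥-elim (¬px p)
count-strict (miss _ cp)  (hit _ cq)   P⊆Q (here refl) qx ¬px = s≤s (count-mono cp cq P⊆Q)
count-strict (miss _ cp)  (miss ¬q cq) P⊆Q (here refl) qx ¬px = ⊥-elim (¬q qx)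
count-strict (hit p cp)   (hit q cq)   P⊆Q (there x∈) qx ¬px = s≤s (count-strict cp cq P⊆Q x∈ qx ¬px)
count-strict (hit p cp)   (miss ¬q cq) P⊆Q (there x∈) qx ¬px = ⊥-elim (¬q (P⊆Q p))
count-strict (miss _ cp)  (hit q cq)   P⊆Q (there x∈) qx ¬px = m≤n⇒m≤1+n (count-strict cp cq P⊆Q x∈ qx ¬px)
count-strict (miss _ cp)  (miss _ cq)  P⊆Q (there x∈) qx ¬px = count-strict cp cq P⊆Q x∈ qx ¬px

count-take-disjoint : ∀ t xs {a b c} → Count P (take t xs) a → Count Q xs b → Count R xs c →
                      P ⊆ R → Q ⊆ R → (∀ {x} → P x → ¬ Q x) → a + b ≤ c
count-take-disjoint zero    xs       nil         cq          cr          P⊆R Q⊆R P∩Q=∅ = count-mono cq cr Q⊆R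
count-take-disjoint (suc t) []       nil         nil         nil         P⊆R Q⊆R P∩Q=∅ = z≤n
count-take-disjoint (suc t) (x ∷ xs) (hit p cp)  (hit q cq)  cr          P⊆R Q⊆R P∩Q=∅ = ⊥-elim (P∩Q=∅ p q)
count-take-disjoint (suc t) (x ∷ xs) (hit p cp)  (miss _ cq) (hit _ cr)  P⊆R Q⊆R P∩Q=∅ =
  s≤s (count-take-disjoint t xs cp cq cr P⊆R Q⊆R P∩Q=∅)
count-take-disjoint (suc t) (x ∷ xs) (hit p cp)  (miss _ cq) (miss ¬r cr) P⊆R Q⊆R P∩Q=∅ = ⊥-elim (¬r (P⊆R p))
count-take-disjoint (suc t) (x ∷ xs) {a} {suc b} {suc c} (miss _ cp) (hit q cq) (hit _ cr) P⊆R Q⊆R P∩Q=∅ =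
  subst (_≤ suc c) (sym (+-suc a b)) (s≤s (count-take-disjoint t xs cp cq cr P⊆R Q⊆R P∩Q=∅))
count-take-disjoint (suc t) (x ∷ xs) (miss _ cp) (hit q cq)  (miss ¬r cr) P⊆R Q⊆R P∩Q=∅ = ⊥-elim (¬r (Q⊆R q))
count-take-disjoint (suc t) (x ∷ xs) (miss _ cp) (miss _ cq) (hit _ cr)  P⊆R Q⊆R P∩Q=∅ =
  m≤n⇒m≤1+n (count-take-disjoint t xs cp cq cr P⊆R Q⊆R P∩Q=∅)
count-take-disjoint (suc t) (x ∷ xs) (miss _ cp) (miss _ cq) (miss _ cr) P⊆R Q⊆R P∩Q=∅ =
  count-take-disjoint t xs cp cq cr P⊆R Q⊆R P∩Q=∅

∈⇒≤foldr-⊔ : (f : A → ℕ) {xs : List A} {x : A} → x ∈ xs → f x ≤ foldr _⊔_ 0 (map f xs)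
∈⇒≤foldr-⊔ f {y ∷ ys} (here refl) = m≤m⊔n (f y) _
∈⇒≤foldr-⊔ f {y ∷ ys} (there x∈) = ≤-trans (∈⇒≤foldr-⊔ f x∈) (m≤n⊔m (f y) _)

predError-bound : ∀ {n} (α̃ δ̃ α δ : Fin n → ℕ) u →
                  ∣ α̃ u - α u ∣ + ∣ δ̃ u - δ u ∣ ≤ predError α̃ δ̃ α δ
predError-bound α̃ δ̃ α δ u = ∈⇒≤foldr-⊔ (λ v → ∣ α̃ v - α v ∣ + ∣ δ̃ v - δ v ∣) (∈-allFin u)

module _ where
  open ≤-Reasoning

  m≤⌈m/n⌉*n : ∀ m n .{{_ : NonZero n}} → m ≤ ⌈ m / n ⌉ * n
  m≤⌈m/n⌉*n m (suc n) = +-cancelʳ-≤ n m _ (begin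
    m + n                                   ≡⟨ m≡m%n+[m/n]*n (m + n) (suc n) ⟩
    (m + n) % suc n + ⌈ m / suc n ⌉ * suc n ≤⟨ +-monoˡ-≤ _ (≤-pred (m%n<n (m + n) (suc n))) ⟩
    n + ⌈ m / suc n ⌉ * suc n               ≡⟨ +-comm n _ ⟩
    ⌈ m / suc n ⌉ * suc n + n               ∎)

  ⌈m/n⌉*n≤m+n : ∀ m n .{{_ : NonZero n}} → ⌈ m / n ⌉ * n ≤ m + n
  ⌈m/n⌉*n≤m+n m (suc n) = ≤-trans (m/n*n≤m (m + n) (suc n)) (+-monoʳ-≤ m (n≤1+n n))

  m≤n+⌊m/n⌋*n : ∀ m n .{{_ : NonZero n}} → m ≤ n + ⌊ m / n ⌋ * n
  m≤n+⌊m/n⌋*n m n = begin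
    m                    ≡⟨ m≡m%n+[m/n]*n m n ⟩
    m % n + ⌊ m / n ⌋ * n ≤⟨ +-monoˡ-≤ _ (<⇒≤ (m%n<n m n)) ⟩
    n + ⌊ m / n ⌋ * n     ∎

  ⌈m/n⌉≤1+⌈o/n⌉⇒m≤o+2*n : ∀ m o n .{{_ : NonZero n}} → ⌈ m / n ⌉ ≤ suc ⌈ o / n ⌉ → m ≤ o + 2 * n
  ⌈m/n⌉≤1+⌈o/n⌉⇒m≤o+2*n m o n adjacent = begin
    m                     ≤⟨ m≤⌈m/n⌉*n m n ⟩
    ⌈ m / n ⌉ * n         ≤⟨ *-monoˡ-≤ n adjacent ⟩
    n + ⌈ o / n ⌉ * n     ≤⟨ +-monoʳ-≤ n (⌈m/n⌉*n≤m+n o n) ⟩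
    n + (o + n)           ≡⟨ solve (o ∷ n ∷ []) ⟩
    o + 2 * n             ∎

  ⌊m/n⌋≤1+⌊o/n⌋⇒m≤o+2*n : ∀ m o n .{{_ : NonZero n}} → ⌊ m / n ⌋ ≤ suc ⌊ o / n ⌋ → m ≤ o + 2 * n
  ⌊m/n⌋≤1+⌊o/n⌋⇒m≤o+2*n m o n adjacent = begin
    m                       ≤⟨ m≤n+⌊m/n⌋*n m n ⟩
    n + ⌊ m / n ⌋ * n       ≤⟨ +-monoʳ-≤ n (*-monoˡ-≤ n adjacent) ⟩
    n + (n + ⌊ o / n ⌋ * n) ≤⟨ +-monoʳ-≤ n (+-monoʳ-≤ n (m/n*n≤m o n)) ⟩
    n + (n + o)             ≡⟨ solve (o ∷ n ∷ []) ⟩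
    o + 2 * n               ∎

  gap-transfer : ∀ {c m n m̃ ñ g η} → c + m ≤ n → ñ ≤ m̃ + g →
                 ∣ ñ - n ∣ ≤ η → ∣ m̃ - m ∣ ≤ η → c ≤ g + 2 * η
  gap-transfer {c} {m} {n} {m̃} {ñ} {g} {η} c+m≤n ñ≤m̃+g ∣ñ-n∣≤η ∣m̃-m∣≤η =
    +-cancelʳ-≤ m c (g + 2 * η) (begin
      c + m                  ≤⟨ c+m≤n ⟩
      n                      ≤⟨ m≤n+∣n-m∣ n ñ ⟩
      ñ + ∣ ñ - n ∣          ≤⟨ +-mono-≤ ñ≤m̃+g ∣ñ-n∣≤η ⟩
      m̃ + g + η              ≤⟨ +-monoˡ-≤ η (+-monoˡ-≤ g (m≤n+∣m-n∣ m̃ m)) ⟩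
      m + ∣ m̃ - m ∣ + g + η  ≤⟨ +-monoˡ-≤ η (+-monoˡ-≤ g (+-monoʳ-≤ m ∣m̃-m∣≤η)) ⟩
      m + η + g + η          ≡⟨ solve (m ∷ η ∷ g ∷ []) ⟩
      g + 2 * η + m          ∎)

CeilLevel : ℤ → ℕ → Set
CeilLevel j p = j ≡ + p ⊎ j ≡ + p +ℤ + 1

FloorLevel : ℤ → ℕ → Set
FloorLevel k p = k ≡ + p ⊎ k ≡ + p -ℤ + 1

CeilLevel-adjacent : ∀ {j p q} → CeilLevel j p → CeilLevel j q → p ≤ suc q
CeilLevel-adjacent         (inj₁ refl) (inj₁ j≡q)   = m≤n⇒m≤1+n (≤-reflexive (+-injective j≡q))
CeilLevel-adjacent {q = q} (inj₁ refl) (inj₂ j≡q+1) = ≤-reflexive (trans (+-injective j≡q+1) (+-comm q 1))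
CeilLevel-adjacent {p = p} (inj₂ refl) (inj₁ j≡q)   =
  m≤n⇒m≤1+n (≤-trans (m≤m+n p 1) (≤-reflexive (+-injective j≡q)))
CeilLevel-adjacent {p = p} {q} (inj₂ refl) (inj₂ j≡q+1) =
  m≤n⇒m≤1+n (≤-reflexive (+-cancelʳ-≡ 1 p q (+-injective j≡q+1)))

FloorLevel-adjacent : ∀ {k p q} → FloorLevel k p → FloorLevel k q → p ≤ suc q
FloorLevel-adjacent                         (inj₁ refl) (inj₁ k≡q)   = m≤n⇒m≤1+n (≤-reflexive (+-injective k≡q))
FloorLevel-adjacent {q = zero}              (inj₁ refl) (inj₂ ())
FloorLevel-adjacent {q = suc q}             (inj₁ refl) (inj₂ k≡q)   = m≤n⇒m≤1+n (m≤n⇒m≤1+n (≤-reflexive (+-injective k≡q)))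
FloorLevel-adjacent {p = zero}              (inj₂ refl) (inj₁ ())
FloorLevel-adjacent {p = zero}              (inj₂ refl) (inj₂ _)     = z≤n
FloorLevel-adjacent {p = suc p}             (inj₂ refl) (inj₁ k≡q)   = s≤s (≤-reflexive (+-injective k≡q))
FloorLevel-adjacent {p = suc p} {q = zero}  (inj₂ refl) (inj₂ ())
FloorLevel-adjacent {p = suc p} {q = suc q} (inj₂ refl) (inj₂ k≡q)   = s≤s (m≤n⇒m≤1+n (≤-reflexive (+-injective k≡q)))

◅⇒⁺ : ∀ {R : A → A → Set} {x y z} → R x y → Star R y z → TransClosure R x z
◅⇒⁺ r ε        = [ r ]
◅⇒⁺ r (s ◅ ss) = r ∷⁺ ◅⇒⁺ s ss

module AcyclicEdgeCounting
  {V X : Set} (_⇝_ : V → V → Set)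
  (⇝-refl : ∀ {x} → x ⇝ x) (⇝-trans : ∀ {x y z} → x ⇝ y → y ⇝ z → x ⇝ z)
  (tail head : X → V) (E : List X)
  (edge⇒⇝ : ∀ {e} → e ∈ E → tail e ⇝ head e)
  (no-back-path : ∀ {e} → e ∈ E → ¬ head e ⇝ tail e)
  (μ : V → ℕ) (μ-counts : ∀ w → Count (λ e → head e ⇝ w) E (μ w))
  where

  μ-strict : ∀ {e w} → e ∈ E → head e ⇝ w → μ (tail e) < μ w
  μ-strict e∈E he⇝w =
    count-strict (μ-counts _) (μ-counts _) (λ h⇝t → ⇝-trans h⇝t (⇝-trans (edge⇒⇝ e∈E) he⇝w))
                 e∈E he⇝w (no-back-path e∈E)

  Source : (H : V → Set) (P : X → Set) → V → Set
  Source H P v = ∃ λ x → H x × x ⇝ v × (∀ {e} → P e → ¬ head e ⇝ x)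

  -- Whether some P-edge enters x is not decidable here, so the descent only yields a source up to
  -- double negation; that suffices because the bound proved from it is decidable.
  ¬¬-source : (H : V → Set) (P : X → Set) → (∀ {e} → P e → e ∈ E × H (tail e)) →
              ∀ {v} → H v → ¬ ¬ Source H P v
  ¬¬-source H P P⇒H-tail {v} hv = descend v (<-wellFounded (μ v)) hv ⇝-refl
    where
    descend : ∀ x → Acc _<_ (μ x) → H x → x ⇝ v → ¬ ¬ Source H P v
    descend x (acc rec) hx x⇝v no-source = no-source (x , hx , x⇝v , λ {e} pe he⇝x →
      let e∈E , h-tail = P⇒H-tail pe in
      descend (tail e) (rec (μ-strict e∈E he⇝x)) h-tail
              (⇝-trans (edge⇒⇝ e∈E) (⇝-trans he⇝x x⇝v)) no-source)

  count-bound : (H : V → Set) (P : X → Set) (μ̃ : V → ℕ) {g η t c : ℕ} {v : V} →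
                (∀ {e} → P e → e ∈ E × H (tail e) × head e ⇝ v) →
                (∀ {x} → H x → μ̃ v ≤ μ̃ x + g) →
                (∀ u → ∣ μ̃ u - μ u ∣ ≤ η) →
                H v → Count P (take t E) c → c ≤ g + 2 * η
  count-bound H P μ̃ {g} {η} {t} {c} {v} P⇒ gap error hv count =
    decidable-stable (c ≤? g + 2 * η)
      (¬¬-map bound (¬¬-source H P (λ pe → let e∈E , h-tail , _ = P⇒ pe in e∈E , h-tail) hv))
    where
    bound : Source H P v → c ≤ g + 2 * η
    bound (x , hx , x⇝v , P-misses-x) =
      gap-transfer {m̃ = μ̃ x} {g = g}
        (count-take-disjoint t E count (μ-counts x) (μ-counts v)
          (λ pe → let _ , _ , h⇝v = P⇒ pe in h⇝v) (λ h⇝x → ⇝-trans h⇝x x⇝v) P-misses-x)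
        (gap hx) (error v) (error x)

lemma4p2 : (n : ℕ) (E : List (Edge n)) → Acyclic E →
    (α δ : Fin n → ℕ) →
    ((v : Fin n) → Count (AncEdge (EdgeOf E) v) E (α v)) →
    ((v : Fin n) → Count (DescEdge (EdgeOf E) v) E (δ v)) →
    (α̃ δ̃ : Fin n → ℕ) →
    (η̂ : ℕ) → .{{_ : NonZero η̂}} →
    (j k : ℤ) → (t : ℕ) → t ≤ length E →
    (v : Fin n) → PossibleLevel η̂ (α̃ v) (δ̃ v) j k →
    let H = λ u → PossibleLevel η̂ (α̃ u) (δ̃ u) j k
        Et = take t E
        R = SubEdge H Et
        η = predError α̃ δ̃ α δ
    in ((c : ℕ) → Count (λ e → SubEdge H Et (Data.Product.proj₁ e) (Data.Product.proj₂ e) × AncEdge R v e) Et c →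
          c ≤ 2 * (η̂ + η))
       × ((c : ℕ) → Count (λ e → SubEdge H Et (Data.Product.proj₁ e) (Data.Product.proj₂ e) × DescEdge R v e) Et c →
          c ≤ 2 * (η̂ + η))
lemma4p2 n E acyclic α δ α-counts δ-counts α̃ δ̃ η̂ j k t _ v hv =
    (λ c → 2*-distrib ∘ Ancestors.count-bound H _ α̃ ancestor-edge ancestor-gap α-error hv)
  , (λ c → 2*-distrib ∘ Descendants.count-bound H _ δ̃ descendant-edge descendant-gap δ-error hv)
  where
  G = EdgeOf E
  H = λ u → PossibleLevel η̂ (α̃ u) (δ̃ u) j k
  Et = take t E
  η = predError α̃ δ̃ α δ

  edge-path : ∀ {e} → e ∈ E → Star G (proj₁ e) (proj₂ e)
  edge-path e∈E = e∈E ◅ ε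

  no-back-path : ∀ {e} → e ∈ E → ¬ Star G (proj₂ e) (proj₁ e)
  no-back-path e∈E back = acyclic _ (◅⇒⁺ e∈E back)

  module Ancestors   = AcyclicEdgeCounting (Star G) ε _◅◅_ proj₁ proj₂ E edge-path no-back-path α α-counts
  -- Descendant edges of v are its ancestor edges for the reversed reachability, with the
  -- endpoints of an edge exchanging roles.
  module Descendants = AcyclicEdgeCounting (flip (Star G)) ε (flip _◅◅_) proj₂ proj₁ E edge-path no-back-path δ δ-counts

  subpath : ∀ {x y} → Star (SubEdge H Et) x y → Star G x y
  subpath = Star.map (λ (e∈Et , _ , _) → lookup (take-⊆ t E) e∈Et)

  ancestor-edge : ∀ {e} → SubEdge H Et (proj₁ e) (proj₂ e) × AncEdge (SubEdge H Et) v e →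
                  e ∈ E × H (proj₁ e) × Star G (proj₂ e) v
  ancestor-edge ((e∈Et , hx , _) , y⇝v) = lookup (take-⊆ t E) e∈Et , hx , subpath y⇝v

  descendant-edge : ∀ {e} → SubEdge H Et (proj₁ e) (proj₂ e) × DescEdge (SubEdge H Et) v e →
                    e ∈ E × H (proj₂ e) × Star G v (proj₁ e)
  descendant-edge ((e∈Et , _ , hy) , v⇝x) = lookup (take-⊆ t E) e∈Et , hy , subpath v⇝x

  ancestor-gap : ∀ {x} → H x → α̃ v ≤ α̃ x + 2 * η̂
  ancestor-gap hx = ⌈m/n⌉≤1+⌈o/n⌉⇒m≤o+2*n _ _ η̂ (CeilLevel-adjacent (proj₁ hv) (proj₁ hx))

  descendant-gap : ∀ {x} → H x → δ̃ v ≤ δ̃ x + 2 * η̂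
  descendant-gap hx = ⌊m/n⌋≤1+⌊o/n⌋⇒m≤o+2*n _ _ η̂ (FloorLevel-adjacent (proj₂ hv) (proj₂ hx))

  α-error : ∀ u → ∣ α̃ u - α u ∣ ≤ η
  α-error u = ≤-trans (m≤m+n _ _) (predError-bound α̃ δ̃ α δ u)

  δ-error : ∀ u → ∣ δ̃ u - δ u ∣ ≤ η
  δ-error u = ≤-trans (m≤n+m _ _) (predError-bound α̃ δ̃ α δ u)

  2*-distrib : ∀ {c} → c ≤ 2 * η̂ + 2 * η → c ≤ 2 * (η̂ + η)
  2*-distrib c≤ = ≤-trans c≤ (≤-reflexive (sym (*-distribˡ-+ 2 η̂ η)))
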